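{- Let $s$ be a positive multiple of $3$. The circle graph $C$ on $6s+1$ vertices determined by the set $\{x\in\mathbb{Z}: 2s/3\le x\le s\}$ has the property that every minimum vertex cover of $C$ contains at least $4s$ vertices.
   Context: For an integer $n\ge 2$ and a set $S\subseteq\{1,\ldots,\lfloor n/2\rfloor\}$, the circle graph on $n$ vertices determined by $S$ is the graph with vertex set $\{0,1,\ldots,n-1\}$ in which two vertices $x,y$ are adjacent if and only if $(x-y)\bmod n\in S$ or $(y-x)\bmod n\in S$. -}

module Defs where

open import Data.Nat using (ℕ; suc; _+_; _*_; _∸_; _≤_; _<_)
open import Data.Nat.DivMod using (_%_)
open import Data.Fin using (Fin; toℕ)
open import Data.Fin.Subset using (Subset; _∈_; ∣_∣)
open import Data.Product using (_×_)
open import Data.Sum using (_⊎_)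

diffMod : {m : ℕ} → Fin (suc m) → Fin (suc m) → ℕ
diffMod {m} x y = ((suc m + toℕ x) ∸ toℕ y) % suc m

CircleAdj : (m : ℕ) → (ℕ → Set) → Fin (suc m) → Fin (suc m) → Set
CircleAdj m S x y = S (diffMod x y) ⊎ S (diffMod y x)

IsVertexCover : {n : ℕ} → (Fin n → Fin n → Set) → Subset n → Set
IsVertexCover {n} Adj V = (x y : Fin n) → Adj x y → (x ∈ V) ⊎ (y ∈ V)

IsMinimumVertexCover : {n : ℕ} → (Fin n → Fin n → Set) → Subset n → Set
IsMinimumVertexCover {n} Adj V =
  IsVertexCover Adj V × ((W : Subset n) → IsVertexCover Adj W → ∣ V ∣ ≤ ∣ W ∣)

Interval : ℕ → ℕ → Set
Interval s x = (2 * s ≤ 3 * x) × (x ≤ s)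

{-# OPTIONS --safe #-}
-- Let s = 3k and n = 18k + 1, and lift the complement I of a vertex cover to an n-periodic subset of ℕ:
-- no two points of I lie at distance in [2k, 3k], and it suffices to show that a period holds at most
-- 6k + 1 of them. On x, x+k, …, x+4k the forbidden distances form a 5-cycle, so any 5k consecutive
-- integers hold at most 2k points of I. If a period held 6k + 2 points, every window of 3k + 1 consecutive
-- integers would then hold at least two. A window starting at a point u would hold fewer than k: the first
-- point after the gap [u+2k, u+3k] is some c + 3k with u < c, which empties [c, c+k], and the second point
-- of the window [c, c+3k] must lie strictly between these two gaps. Six such windows cover a period, so a
-- period would hold fewer than 6k points.
module Submission where

open import Defs
open import Data.Bool using (Bool; true; false)
open import Data.Bool.Properties using (¬-not)
open import Data.Empty using (⊥; ⊥-elim)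
open import Data.Fin using (Fin; toℕ)
open import Data.Fin.Properties using (toℕ<n; toℕ-fromℕ<; fromℕ<-cong; fromℕ<-toℕ)
open import Data.Fin.Subset using (Subset; ∁; ∣_∣)
open import Data.Fin.Subset.Properties using (∣∁p∣≡n∸∣p∣; x∈p⇒x∉∁p; x∈∁p⇒x∉p)
open import Data.Nat using (ℕ; NonZero; zero; suc; pred; _+_; _*_; _∸_; _≤_; _<_; z≤n; s≤s; s≤s⁻¹; _≤?_; _<?_)
open import Data.Nat.Divisibility using (_∣_; divides)
open import Data.Nat.DivMod using (_%_; _mod_; m%n<n; m<n⇒m%n≡m; [m+n]%n≡m%n; %-distribˡ-+)
open import Data.Nat.Properties
open import Algebra.Properties.CommutativeSemigroup +-commutativeSemigroup using (xy∙z≈xz∙y; x∙yz≈y∙zx)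
open import Data.Nat.Tactic.RingSolver using (solve-∀)
open import Data.Product using (∃-syntax; _×_; _,_)
open import Data.Sum using (inj₁; inj₂)
open import Data.Vec using ([]; _∷_; lookup)
open import Data.Vec.Properties using (lookup⇒[]=)
open import Relation.Nullary using (yes; no; contradiction)
open import Relation.Binary.PropositionalEquality

bit : Bool → ℕ
bit false = 0
bit true  = 1

bit≤1 : ∀ b → bit b ≤ 1
bit≤1 false = z≤n
bit≤1 true  = s≤s z≤n

count : (ℕ → Bool) → ℕ → ℕ → ℕ
count f a zero    = 0
count f a (suc L) = bit (f a) + count f (suc a) L

module _ (f : ℕ → Bool) where

  count-+ : ∀ a L M → count f a (L + M) ≡ count f a L + count f (a + L) M
  count-+ a zero    M = cong (λ b → count f b M) (sym (+-identityʳ a))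
  count-+ a (suc L) M = begin
    bit (f a) + count f (suc a) (L + M)                     ≡⟨ cong (bit (f a) +_) (count-+ (suc a) L M) ⟩
    bit (f a) + (count f (suc a) L + count f (suc a + L) M) ≡⟨ +-assoc (bit (f a)) _ _ ⟨
    count f a (suc L) + count f (suc (a + L)) M             ≡⟨ cong (λ b → count f a (suc L) + count f b M) (+-suc a L) ⟨
    count f a (suc L) + count f (a + suc L) M               ∎
    where open ≡-Reasoning

  count-snoc : ∀ a L → count f a (suc L) ≡ count f a L + bit (f (a + L))
  count-snoc a L = begin
    count f a (suc L)                     ≡⟨ cong (count f a) (+-comm 1 L) ⟩
    count f a (L + 1)                     ≡⟨ count-+ a L 1 ⟩
    count f a L + (bit (f (a + L)) + 0)   ≡⟨ cong (count f a L +_) (+-identityʳ _) ⟩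
    count f a L + bit (f (a + L))         ∎
    where open ≡-Reasoning

  count≤length : ∀ a L → count f a L ≤ L
  count≤length a zero    = z≤n
  count≤length a (suc L) = +-mono-≤ (bit≤1 (f a)) (count≤length (suc a) L)

  count-mono-≤ : ∀ a {L M} → L ≤ M → count f a L ≤ count f a M
  count-mono-≤ a {L} L≤M with m≤n⇒∃[o]m+o≡n L≤M
  ... | o , refl = begin
    count f a L                         ≤⟨ m≤m+n _ _ ⟩
    count f a L + count f (a + L) o     ≡⟨ count-+ a L o ⟨
    count f a (L + o)                   ∎
    where open ≤-Reasoning

  count-periodic : ∀ {n} → (∀ x → f (x + n) ≡ f x) → ∀ a → count f a n ≡ count f 0 n
  count-periodic         periodic zero    = refl
  count-periodic {n} periodic (suc a) = trans rotate (count-periodic periodic a)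
    where
    rotate : count f (suc a) n ≡ count f a n
    rotate = +-cancelˡ-≡ (bit (f a)) _ _ (begin
      count f a (suc n)               ≡⟨ count-snoc a n ⟩
      count f a n + bit (f (a + n))   ≡⟨ cong (λ b → count f a n + bit b) (periodic a) ⟩
      count f a n + bit (f a)         ≡⟨ +-comm (count f a n) _ ⟩
      bit (f a) + count f a n         ∎)
      where open ≡-Reasoning

  count≡0⇒¬true : ∀ {a L x} → count f a L ≡ 0 → a ≤ x → x < a + L → f x ≢ true
  count≡0⇒¬true {a} {zero}  _ a≤x x<a+0 = contradiction (≤-trans x<a+0 (≤-reflexive (+-identityʳ a))) (≤⇒≯ a≤x)
  count≡0⇒¬true {a} {suc L} {x} empty a≤x x<end with m≤n⇒m<n∨m≡n a≤x
  ... | inj₂ refl with f a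
  ...   | false = λ ()
  count≡0⇒¬true {a} {suc L} {x} empty a≤x x<end | inj₁ a<x with f a
  ...   | false = count≡0⇒¬true empty a<x (subst (x <_) (+-suc a L) x<end)

  false⇒count≡0 : ∀ a L → (∀ t → t < L → f (a + t) ≡ false) → count f a L ≡ 0
  false⇒count≡0 a zero    _     = refl
  false⇒count≡0 a (suc L) false-at
    rewrite trans (cong f (sym (+-identityʳ a))) (false-at 0 (s≤s z≤n)) =
    false⇒count≡0 (suc a) L (λ t t<L → trans (cong f (sym (+-suc a t))) (false-at (suc t) (s≤s t<L)))

  first-true : ∀ a L → 0 < count f a L → ∃[ j ] j < L × f (a + j) ≡ true × count f a j ≡ 0
  first-true a (suc L) positive with f a in fa
  ... | true  = 0 , s≤s z≤n , trans (cong f (+-identityʳ a)) fa , refl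
  ... | false with first-true (suc a) L positive
  ...   | j , j<L , fj , empty = suc j , s≤s j<L , trans (cong f (+-suc a j)) fj ,
                           trans (cong (λ b → bit b + count f (suc a) j) fa) empty

  count-after-empty : ∀ a {j L} → count f a j ≡ 0 → j ≤ L → count f a L ≤ count f (a + j) L
  count-after-empty a {j} empty j≤L with m≤n⇒∃[o]m+o≡n j≤L
  ... | o , refl = begin
    count f a (j + o)                   ≡⟨ count-+ a j o ⟩
    count f a j + count f (a + j) o     ≡⟨ cong (_+ count f (a + j) o) empty ⟩
    count f (a + j) o                   ≤⟨ count-mono-≤ (a + j) (m≤n+m o j) ⟩
    count f (a + j) (j + o)             ∎
    where open ≤-Reasoning

  count-+-empty : ∀ a L M → count f (a + L) M ≡ 0 → count f a (L + M) ≡ count f a L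
  count-+-empty a L M empty = trans (count-+ a L M) (trans (cong (count f a L +_) empty) (+-identityʳ _))

  count-two-gaps : ∀ a A B M D → A + B ≤ M → count f (a + A) B ≡ 0 → count f (a + M) D ≡ 0 →
                   count f a (M + D) + B ≤ M
  count-two-gaps a A B M D A+B≤M gap₁ gap₂ with m≤n⇒∃[o]m+o≡n A+B≤M
  ... | C , refl = begin
    count f a (A + B + C + D) + B                      ≡⟨ cong (_+ B) (count-+-empty a (A + B + C) D gap₂) ⟩
    count f a (A + B + C) + B                          ≡⟨ cong (_+ B) (count-+ a (A + B) C) ⟩
    count f a (A + B) + count f (a + (A + B)) C + B    ≡⟨ cong (λ g → g + count f (a + (A + B)) C + B) (count-+-empty a A B gap₁) ⟩
    count f a A + count f (a + (A + B)) C + B          ≤⟨ +-monoˡ-≤ B (+-mono-≤ (count≤length a A) (count≤length _ C)) ⟩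
    A + C + B                                          ≡⟨ xy∙z≈xz∙y A C B ⟩
    A + B + C                                          ∎
    where open ≤-Reasoning

  count-*-≤ : ∀ L c → (∀ a → count f a L ≤ c) → ∀ m a → count f a (m * L) ≤ m * c
  count-*-≤ L c bounded zero    a = z≤n
  count-*-≤ L c bounded (suc m) a = begin
    count f a (L + m * L)                   ≡⟨ count-+ a L (m * L) ⟩
    count f a L + count f (a + L) (m * L)   ≤⟨ +-mono-≤ (bounded a) (count-*-≤ L c bounded m (a + L)) ⟩
    c + m * c                               ∎
    where open ≤-Reasoning

m+1+n≤2n⇒m<n : ∀ m n → m + suc n ≤ 2 * n → m < n
m+1+n≤2n⇒m<n m n le = +-cancelʳ-≤ n (suc m) n (begin
  suc m + n   ≡⟨ +-suc m n ⟨
  m + suc n   ≤⟨ le ⟩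
  n + (n + 0) ≡⟨ cong (n +_) (+-identityʳ n) ⟩
  n + n       ∎)
  where open ≤-Reasoning

m+2n≡m+n+n : ∀ m n → m + 2 * n ≡ m + n + n
m+2n≡m+n+n = solve-∀

m+3n≡m+n+n+n : ∀ m n → m + 3 * n ≡ m + n + n + n
m+3n≡m+n+n+n = solve-∀

+-interchange₅ : ∀ a b c d e a₁ b₁ c₁ d₁ e₁ →
                 (a + a₁) + ((b + b₁) + ((c + c₁) + ((d + d₁) + (e + e₁)))) ≡
                 (a + (b + (c + (d + e)))) + (a₁ + (b₁ + (c₁ + (d₁ + e₁))))
+-interchange₅ = solve-∀

-- each vertex of the 5-cycle 0-2-4-1-3-0 lies on two of its edges
cycle₅-double-count : ∀ a b c d e →
                      2 * (a + (b + (c + (d + e)))) ≡ (a + c) + (c + e) + (b + e) + (b + d) + (a + d)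
cycle₅-double-count = solve-∀

m+[1+o]+3n≡m+2n+[1+n+o] : ∀ m n o → m + suc o + 3 * n ≡ m + 2 * n + (suc n + o)
m+[1+o]+3n≡m+2n+[1+n+o] = solve-∀

module DistanceFree (k : ℕ) (f : ℕ → Bool)
  (apart : ∀ x d → f x ≡ true → 2 * k ≤ d → d ≤ 3 * k → f (x + d) ≡ false) where

  2k≤3k : 2 * k ≤ 3 * k
  2k≤3k = *-monoˡ-≤ k {2} {3} (s≤s (s≤s z≤n))

  at-most-one : ∀ x d → 2 * k ≤ d → d ≤ 3 * k → bit (f x) + bit (f (x + d)) ≤ 1
  at-most-one x d lo hi with f x in fx
  ... | false = bit≤1 (f (x + d))
  ... | true  = ≤-reflexive (cong (λ b → 1 + bit b) (apart x d fx lo hi))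

  at-most-one-of-2k : ∀ y → bit (f y) + bit (f (y + k + k)) ≤ 1
  at-most-one-of-2k y = subst (λ z → bit (f y) + bit (f z) ≤ 1) (m+2n≡m+n+n y k) (at-most-one y (2 * k) ≤-refl 2k≤3k)

  at-most-one-of-3k : ∀ y → bit (f y) + bit (f (y + k + k + k)) ≤ 1
  at-most-one-of-3k y = subst (λ z → bit (f y) + bit (f z) ≤ 1) (m+3n≡m+n+n+n y k) (at-most-one y (3 * k) 2k≤3k ≤-refl)

  Σ₅ : (ℕ → ℕ) → ℕ → ℕ
  Σ₅ g x = g x + (g (x + k) + (g (x + k + k) + (g (x + k + k + k) + g (x + k + k + k + k))))

  Σ₅-+ : ∀ g h x → Σ₅ (λ y → g y + h y) x ≡ Σ₅ g x + Σ₅ h x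
  Σ₅-+ g h x = +-interchange₅ (g x) (g (x + k)) (g (x + k + k)) (g (x + k + k + k)) (g (x + k + k + k + k))
                              (h x) (h (x + k)) (h (x + k + k)) (h (x + k + k + k)) (h (x + k + k + k + k))

  pentagon : ∀ x → Σ₅ (λ y → bit (f y)) x ≤ 2
  pentagon x = s≤s⁻¹ (*-cancelˡ-< 2 _ 3 (begin-strict
    2 * Σ₅ b x                              ≡⟨ cycle₅-double-count (b x₀) (b x₁) (b x₂) (b x₃) (b x₄) ⟩
    (b x₀ + b x₂) + (b x₂ + b x₄) + (b x₁ + b x₄) + (b x₁ + b x₃) + (b x₀ + b x₃)
                                            ≤⟨ +-mono-≤ (+-mono-≤ (+-mono-≤ (+-mono-≤
                                                 (at-most-one-of-2k x₀) (at-most-one-of-2k x₂))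
                                                 (at-most-one-of-3k x₁)) (at-most-one-of-2k x₁)) (at-most-one-of-3k x₀) ⟩
    5                                       <⟨ ≤-refl ⟩
    6                                       ∎))
    where
    open ≤-Reasoning
    b : ℕ → ℕ
    b y = bit (f y)
    x₀ x₁ x₂ x₃ x₄ : ℕ
    x₀ = x
    x₁ = x + k
    x₂ = x + k + k
    x₃ = x + k + k + k
    x₄ = x + k + k + k + k

  pentagon-count : ∀ x i → Σ₅ (λ y → count f y i) x ≤ 2 * i
  pentagon-count x zero    = z≤n
  pentagon-count x (suc i) = begin
    Σ₅ (λ y → bit (f y) + count f (suc y) i) x                  ≡⟨ Σ₅-+ (λ y → bit (f y)) (λ y → count f (suc y) i) x ⟩
    Σ₅ (λ y → bit (f y)) x + Σ₅ (λ y → count f y i) (suc x)     ≤⟨ +-mono-≤ (pentagon x) (pentagon-count (suc x) i) ⟩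
    2 + 2 * i                                                   ≡⟨ *-suc 2 i ⟨
    2 * suc i                                                   ∎
    where open ≤-Reasoning

  count-5k : ∀ x → count f x (5 * k) ≤ 2 * k
  count-5k x = begin
    count f x (k + 4 * k)                                     ≡⟨ count-+ f x k _ ⟩
    c x + count f (x + k) (k + 3 * k)                         ≡⟨ cong (c x +_) (count-+ f _ k _) ⟩
    c x + (c (x + k) + count f (x + k + k) (k + 2 * k))       ≡⟨ cong (λ g → c x + (c (x + k) + g)) (count-+ f _ k _) ⟩
    c x + (c (x + k) + (c (x + k + k) + count f (x + k + k + k) (k + 1 * k)))
                                                              ≡⟨ cong (λ g → c x + (c (x + k) + (c (x + k + k) + g))) (count-+ f _ k _) ⟩
    c x + (c (x + k) + (c (x + k + k) + (c (x + k + k + k) + count f (x + k + k + k + k) (k + 0))))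
                                                              ≡⟨ cong (λ L → c x + (c (x + k) + (c (x + k + k) + (c (x + k + k + k) + count f (x + k + k + k + k) L)))) (+-identityʳ k) ⟩
    Σ₅ c x                                                    ≤⟨ pentagon-count x k ⟩
    2 * k                                                     ∎
    where
    open ≤-Reasoning
    c : ℕ → ℕ
    c y = count f y k

  gap-after : ∀ {u} → f u ≡ true → count f (u + 2 * k) (suc k) ≡ 0
  gap-after {u} fu = false⇒count≡0 f (u + 2 * k) (suc k) λ t t<1+k →
    subst (λ x → f x ≡ false) (sym (+-assoc u (2 * k) t))
          (apart u (2 * k + t) fu (m≤m+n (2 * k) t) (2k+t≤3k (s≤s⁻¹ t<1+k)))
    where
    2k+t≤3k : ∀ {t} → t ≤ k → 2 * k + t ≤ 3 * k
    2k+t≤3k {t} t≤k = subst (2 * k + t ≤_) (+-comm (2 * k) k) (+-monoʳ-≤ (2 * k) t≤k)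

  gap-before : ∀ {c} → f (c + 3 * k) ≡ true → count f c (suc k) ≡ 0
  gap-before {c} fc = false⇒count≡0 f c (suc k) λ t t<1+k → ¬-not (not-member (s≤s⁻¹ t<1+k))
    where
    not-member : ∀ {t} → t ≤ k → f (c + t) ≢ true
    not-member {t} t≤k fct =
      contradiction (trans (sym fc) (subst (λ x → f x ≡ false) c+t+[3k∸t]≡c+3k (apart (c + t) (3 * k ∸ t) fct 2k≤3k∸t (m∸n≤m (3 * k) t)))) λ ()
      where
      c+t+[3k∸t]≡c+3k : c + t + (3 * k ∸ t) ≡ c + 3 * k
      c+t+[3k∸t]≡c+3k = trans (+-assoc c t _) (cong (c +_) (m+[n∸m]≡n (≤-trans t≤k (m≤m+n k (2 * k)))))
      2k≤3k∸t : 2 * k ≤ 3 * k ∸ t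
      2k≤3k∸t = subst (_≤ 3 * k ∸ t) (m+n∸m≡n k (2 * k)) (∸-monoʳ-≤ (3 * k) t≤k)

  module Dense (n : ℕ) (periodic : ∀ x → f (x + n) ≡ f x) (n≤ : n ≤ 1 + 18 * k)
               (dense : 1 + 6 * k < count f 0 n) where

    window≥2 : ∀ x → 2 ≤ count f x (suc (3 * k))
    window≥2 x = +-cancelʳ-≤ (6 * k) 2 _ (begin
      2 + 6 * k                                               ≤⟨ dense ⟩
      count f 0 n                                             ≡⟨ count-periodic f periodic x ⟨
      count f x n                                             ≤⟨ count-mono-≤ f x (≤-trans n≤ (≤-reflexive (cong suc (18k≡3k+3*5k k)))) ⟩
      count f x (suc (3 * k) + 3 * (5 * k))                   ≡⟨ count-+ f x (suc (3 * k)) (3 * (5 * k)) ⟩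
      count f x (suc (3 * k)) + count f _ (3 * (5 * k))       ≤⟨ +-monoʳ-≤ _ (count-*-≤ f (5 * k) (2 * k) count-5k 3 _) ⟩
      count f x (suc (3 * k)) + 3 * (2 * k)                   ≡⟨ cong (count f x (suc (3 * k)) +_) (*-assoc 3 2 k) ⟨
      count f x (suc (3 * k)) + 6 * k                         ∎)
      where
      open ≤-Reasoning
      18k≡3k+3*5k : ∀ m → 18 * m ≡ 3 * m + 3 * (5 * m)
      18k≡3k+3*5k = solve-∀

    occupied : ∀ a → 0 < count f a (suc (3 * k))
    occupied a = ≤-trans (n≤1+n 1) (window≥2 a)

    next-member : ∀ {u} → f u ≡ true → ∃[ e ] f (u + suc e + 3 * k) ≡ true × count f (u + 2 * k) (suc k + e) ≡ 0
    next-member {u} fu = after-gap (first-true f (u + 2 * k) (suc (3 * k)) (occupied (u + 2 * k)))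
      where
      after-gap : ∃[ j ] j < suc (3 * k) × f (u + 2 * k + j) ≡ true × count f (u + 2 * k) j ≡ 0 →
                  ∃[ e ] f (u + suc e + 3 * k) ≡ true × count f (u + 2 * k) (suc k + e) ≡ 0
      after-gap (j , _ , fj , empty) with k <? j
      ... | no j≤k = contradiction fj
                       (count≡0⇒¬true f (gap-after fu) (m≤m+n (u + 2 * k) j) (+-monoʳ-< (u + 2 * k) (s≤s (≮⇒≥ j≤k))))
      ... | yes k<j with m≤n⇒∃[o]m+o≡n k<j
      ...   | e , refl = e , subst (λ x → f x ≡ true) (sym (m+[1+o]+3n≡m+2n+[1+n+o] u k e)) fj , empty

    inner-member : ∀ {c} → f (c + 3 * k) ≡ true → ∃[ i ] k < i × i < 3 * k × f (c + i) ≡ true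
    inner-member {c} fc = beyond-gap (first-true f c (3 * k) (+-cancelʳ-≤ 1 1 _ (begin
      2                                        ≤⟨ window≥2 c ⟩
      count f c (suc (3 * k))                  ≡⟨ count-snoc f c (3 * k) ⟩
      count f c (3 * k) + bit (f (c + 3 * k))  ≡⟨ cong (λ b → count f c (3 * k) + bit b) fc ⟩
      count f c (3 * k) + 1                    ∎)))
      where
      open ≤-Reasoning
      beyond-gap : ∃[ i ] i < 3 * k × f (c + i) ≡ true × count f c i ≡ 0 → ∃[ i ] k < i × i < 3 * k × f (c + i) ≡ true
      beyond-gap (i , i<3k , fi , _) with k <? i
      ... | yes k<i = i , k<i , i<3k , fi
      ... | no i≤k  = contradiction fi (count≡0⇒¬true f (gap-before fc) (m≤m+n c i) (+-monoʳ-< c (s≤s (≮⇒≥ i≤k))))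

    window<k-from-member : ∀ {u} → f u ≡ true → count f u (suc (3 * k)) < k
    window<k-from-member {u} fu =
      let e , fc , empty     = next-member fu
          i , k<i , i<3k , fi = inner-member fc
          below : u + suc e + i < u + 2 * k
          below = ≰⇒> λ u+2k≤c+i → count≡0⇒¬true f empty u+2k≤c+i
                    (subst (u + suc e + i <_) (m+[1+o]+3n≡m+2n+[1+n+o] u k e) (+-monoʳ-< (u + suc e) i<3k)) fi
          fits : suc e + suc k ≤ 2 * k
          fits = ≤-trans (+-monoʳ-≤ (suc e) k<i)
                   (<⇒≤ (+-cancelˡ-< u (suc e + i) (2 * k) (subst (_< u + 2 * k) (+-assoc u (suc e) i) below)))
      in m+1+n≤2n⇒m<n _ k (subst (λ L → count f u L + suc k ≤ 2 * k) (+-comm (2 * k) (suc k))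
           (count-two-gaps f u (suc e) (suc k) (2 * k) (suc k) fits (gap-before fc) (gap-after fu)))

    window<k : ∀ x → count f x (suc (3 * k)) < k
    window<k x =
      let j , j<w , fj , empty = first-true f x (suc (3 * k)) (occupied x)
      in ≤-<-trans (count-after-empty f x empty (<⇒≤ j<w)) (window<k-from-member fj)

    absurd : ⊥
    absurd = <-irrefl refl (begin-strict
      1 + 6 * k                     <⟨ dense ⟩
      count f 0 n                   ≤⟨ count-mono-≤ f 0 (≤-trans n≤ six-windows) ⟩
      count f 0 (6 * suc (3 * k))   ≤⟨ count-*-≤ f (suc (3 * k)) (pred k) (λ a → <⇒≤pred (window<k a)) 6 0 ⟩
      6 * pred k                    ≤⟨ *-monoʳ-≤ 6 (pred[n]≤n {k}) ⟩
      6 * k                         ≤⟨ m≤n+m (6 * k) 1 ⟩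
      1 + 6 * k                     ∎)
      where
      open ≤-Reasoning
      six-windows : 1 + 18 * k ≤ 6 * suc (3 * k)
      six-windows = begin
        1 + 18 * k         ≤⟨ +-monoˡ-≤ (18 * k) {1} {6} (s≤s z≤n) ⟩
        6 + 18 * k         ≡⟨ cong (6 +_) (*-assoc 6 3 k) ⟩
        6 + 6 * (3 * k)    ≡⟨ *-suc 6 (3 * k) ⟨
        6 * suc (3 * k)    ∎

  period-bound : ∀ n → (∀ x → f (x + n) ≡ f x) → n ≤ 1 + 18 * k → count f 0 n ≤ 1 + 6 * k
  period-bound n periodic n≤ with count f 0 n ≤? 1 + 6 * k
  ... | yes bounded   = bounded
  ... | no  unbounded = ⊥-elim (Dense.absurd n periodic n≤ (≰⇒> unbounded))

[n+[m+d]%n∸m%n]%n≡d : ∀ n .{{_ : NonZero n}} m d → d < n → (n + (m + d) % n ∸ m % n) % n ≡ d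
[n+[m+d]%n∸m%n]%n≡d n m d d<n with m % n + d <? n
... | yes r+d<n = begin
  (n + (m + d) % n ∸ r) % n   ≡⟨ cong (λ z → (n + z ∸ r) % n) (trans [m+d]%n≡[r+d]%n (m<n⇒m%n≡m r+d<n)) ⟩
  (n + (r + d) ∸ r) % n       ≡⟨ cong (λ z → (z ∸ r) % n) (x∙yz≈y∙zx n r d) ⟩
  (r + (d + n) ∸ r) % n       ≡⟨ cong (_% n) (m+n∸m≡n r (d + n)) ⟩
  (d + n) % n                 ≡⟨ [m+n]%n≡m%n d n ⟩
  d % n                       ≡⟨ m<n⇒m%n≡m d<n ⟩
  d                           ∎
  where
  open ≡-Reasoning
  r : ℕ
  r = m % n
  [m+d]%n≡[r+d]%n : (m + d) % n ≡ (r + d) % n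
  [m+d]%n≡[r+d]%n = trans (%-distribˡ-+ m d n) (cong (λ z → (r + z) % n) (m<n⇒m%n≡m d<n))
... | no n≤r+d with m≤n⇒∃[o]m+o≡n (≮⇒≥ n≤r+d)
...   | t , n+t≡r+d = begin
  (n + (m + d) % n ∸ r) % n   ≡⟨ cong (λ z → (n + z ∸ r) % n) [m+d]%n≡t ⟩
  (n + t ∸ r) % n             ≡⟨ cong (λ z → (z ∸ r) % n) n+t≡r+d ⟩
  (r + d ∸ r) % n             ≡⟨ cong (_% n) (m+n∸m≡n r d) ⟩
  d % n                       ≡⟨ m<n⇒m%n≡m d<n ⟩
  d                           ∎
  where
  open ≡-Reasoning
  r : ℕ
  r = m % n
  t<n : t < n
  t<n = +-cancelˡ-< n t n (subst (_< n + n) (sym n+t≡r+d) (+-mono-< (m%n<n m n) d<n))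
  [m+d]%n≡t : (m + d) % n ≡ t
  [m+d]%n≡t = begin
    (m + d) % n               ≡⟨ %-distribˡ-+ m d n ⟩
    (r + d % n) % n           ≡⟨ cong (λ z → (r + z) % n) (m<n⇒m%n≡m d<n) ⟩
    (r + d) % n               ≡⟨ cong (_% n) (trans (sym n+t≡r+d) (+-comm n t)) ⟩
    (t + n) % n               ≡⟨ [m+n]%n≡m%n t n ⟩
    t % n                     ≡⟨ m<n⇒m%n≡m t<n ⟩
    t                         ∎

diffMod-mod : ∀ {m} x d → d < suc m → diffMod ((x + d) mod suc m) (x mod suc m) ≡ d
diffMod-mod {m} x d d<n =
  trans (cong₂ (λ a b → (suc m + a ∸ b) % suc m) (toℕ-fromℕ< (m%n<n (x + d) (suc m))) (toℕ-fromℕ< (m%n<n x (suc m))))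
        ([n+[m+d]%n∸m%n]%n≡d (suc m) x d d<n)

count-shift : ∀ f a L → count f (suc a) L ≡ count (λ x → f (suc x)) a L
count-shift f a zero    = refl
count-shift f a (suc L) = cong (bit (f (suc a)) +_) (count-shift f (suc a) L)

count-lookup : ∀ {m} (p : Subset m) (f : ℕ → Bool) →
               (∀ i → f (toℕ i) ≡ lookup p i) → count f 0 m ≡ ∣ p ∣
count-lookup []      f f≗p = refl
count-lookup {suc m} (b ∷ p) f f≗p = begin
  bit (f 0) + count f 1 m                  ≡⟨ cong₂ _+_ (cong bit (f≗p Fin.zero)) (count-shift f 0 m) ⟩
  bit b + count (λ x → f (suc x)) 0 m      ≡⟨ cong (bit b +_) (count-lookup p _ (λ i → f≗p (Fin.suc i))) ⟩
  bit b + ∣ p ∣                            ≡⟨ bit+∣p∣ b ⟩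
  ∣ b ∷ p ∣                                ∎
  where
  open ≡-Reasoning
  bit+∣p∣ : ∀ b → bit b + ∣ p ∣ ≡ ∣ b ∷ p ∣
  bit+∣p∣ false = refl
  bit+∣p∣ true  = refl

module CircleCover {m : ℕ} (S : ℕ → Set) (V : Subset (suc m)) (cover : IsVertexCover (CircleAdj m S) V) where

  outside : ℕ → Bool
  outside x = lookup (∁ V) (x mod suc m)

  outside-periodic : ∀ x → outside (x + suc m) ≡ outside x
  outside-periodic x = cong (lookup (∁ V)) (fromℕ<-cong _ _ ([m+n]%n≡m%n x (suc m)) (m%n<n (x + suc m) (suc m)) (m%n<n x (suc m)))

  count-outside : count outside 0 (suc m) ≡ ∣ ∁ V ∣
  count-outside = count-lookup (∁ V) outside λ i →
    cong (lookup (∁ V)) (trans (fromℕ<-cong _ _ (m<n⇒m%n≡m (toℕ<n i)) _ (toℕ<n i)) (fromℕ<-toℕ i (toℕ<n i)))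

  outside-apart : ∀ x d → d < suc m → S d → outside x ≡ true → outside (x + d) ≡ false
  outside-apart x d d<n Sd x∉V with cover ((x + d) mod suc m) (x mod suc m) (inj₁ (subst S (sym (diffMod-mod x d d<n)) Sd))
  ... | inj₁ x+d∈V = ¬-not λ x+d∉V → x∈p⇒x∉∁p x+d∈V (lookup⇒[]= _ (∁ V) x+d∉V)
  ... | inj₂ x∈V   = contradiction x∈V (x∈∁p⇒x∉p (lookup⇒[]= _ (∁ V) x∉V))

Interval-of-multiple : ∀ k d → 2 * k ≤ d → d ≤ 3 * k → Interval (k * 3) d
Interval-of-multiple k d lo hi =
  subst (_≤ 3 * d) (3*[2*m]≡2*[m*3] k) (*-monoʳ-≤ 3 lo) , subst (d ≤_) (*-comm 3 k) hi
  where
  3*[2*m]≡2*[m*3] : ∀ m → 3 * (2 * m) ≡ 2 * (m * 3)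
  3*[2*m]≡2*[m*3] = solve-∀

cover-complement≤1+6k : ∀ k (V : Subset (suc (6 * (k * 3)))) →
                        IsVertexCover (CircleAdj (6 * (k * 3)) (Interval (k * 3))) V →
                        suc (6 * (k * 3)) ∸ ∣ V ∣ ≤ 1 + 6 * k
cover-complement≤1+6k k V cover = begin
  n ∸ ∣ V ∣           ≡⟨ ∣∁p∣≡n∸∣p∣ V ⟨
  ∣ ∁ V ∣             ≡⟨ count-outside ⟨
  count outside 0 n   ≤⟨ period-bound n outside-periodic (≤-reflexive (1+6[3m]≡1+18m k)) ⟩
  1 + 6 * k           ∎
  where
  open ≤-Reasoning
  open CircleCover (Interval (k * 3)) V cover
  n : ℕ
  n = suc (6 * (k * 3))
  1+6[3m]≡1+18m : ∀ m → suc (6 * (m * 3)) ≡ 1 + 18 * m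
  1+6[3m]≡1+18m = solve-∀
  d<n : ∀ {d} → d ≤ 3 * k → d < n
  d<n {d} d≤3k = s≤s (≤-trans (subst (d ≤_) (*-comm 3 k) d≤3k) (m≤n*m (k * 3) 6))
  open DistanceFree k outside (λ x d x∉V lo hi → outside-apart x d (d<n hi) (Interval-of-multiple k d lo hi) x∉V)

lemma3 : (s : ℕ) → 0 < s → 3 ∣ s →
         (V : Subset (suc (6 * s))) →
         IsMinimumVertexCover (CircleAdj (6 * s) (Interval s)) V →
         4 * s ≤ ∣ V ∣
lemma3 .(k * 3) _ (divides k refl) V (cover , _) = +-cancelʳ-≤ (1 + 6 * k) (4 * (k * 3)) ∣ V ∣ (begin
  4 * (k * 3) + (1 + 6 * k)          ≡⟨ 12m+[1+6m]≡1+6[3m] k ⟩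
  suc (6 * (k * 3))                  ≤⟨ m≤n+m∸n _ ∣ V ∣ ⟩
  ∣ V ∣ + (suc (6 * (k * 3)) ∸ ∣ V ∣) ≤⟨ +-monoʳ-≤ ∣ V ∣ (cover-complement≤1+6k k V cover) ⟩
  ∣ V ∣ + (1 + 6 * k)                ∎)
  where
  open ≤-Reasoning
  12m+[1+6m]≡1+6[3m] : ∀ m → 4 * (m * 3) + (1 + 6 * m) ≡ suc (6 * (m * 3))
  12m+[1+6m]≡1+6[3m] = solve-∀
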